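{- For every pair of integers $a,b$ with $3\le a\le b+1$, there exists a connected graph $G$ with $\eta_p(G)=a$ and $\eta(G)=b$.
   Context: Graphs are finite, simple, undirected and connected. A set $S\subseteq V(G)$ is resolving if for every pair of distinct $v,w\in V(G)$ there is $x\in S$ with $d(v,x)\ne d(w,x)$; dominating if every vertex not in $S$ has a neighbor in $S$. $\eta(G)$ is the minimum cardinality of a set that is both resolving and dominating. For $v\in V(G)$ and $S\subseteq V(G)$, $d(v,S)=\min\{d(v,w):w\in S\}$. For a partition $\Pi=\{S_1,\dots,S_k\}$ of $V(G)$, $r(u|\Pi)=(d(u,S_1),\dots,d(u,S_k))$; $\Pi$ is resolving if $r(u|\Pi)\ne r(v|\Pi)$ for all distinct $u,v$, and dominating if each vertex $v$ has $d(v,S_j)=1$ for some $j$. $\eta_p(G)$ is the minimum cardinality of a partition that is both resolving and dominating. -}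

module Defs where

open import Data.Nat using (ℕ; zero; suc; _≤_)
open import Data.Fin using (Fin)
open import Data.Fin.Subset using (Subset; _∈_; _∉_; ∣_∣)
open import Data.Product using (Σ; ∃; ∃-syntax; _×_; _,_)
open import Relation.Binary.PropositionalEquality using (_≡_; _≢_)
open import Relation.Nullary using (¬_)
open import Level using (0ℓ)

record Graph : Set₁ where
  field
    n      : ℕ
    Adj    : Fin n → Fin n → Set
    sym    : ∀ {u v} → Adj u v → Adj v u
    irrefl : ∀ {u} → ¬ Adj u u
open Graph public

module _ (G : Graph) where

  data Walk : Fin (n G) → Fin (n G) → ℕ → Set where
    here : ∀ {u} → Walk u u zero
    step : ∀ {u v w k} → Adj G u v → Walk v w k → Walk u w (suc k)

  Connected : Set
  Connected = ∀ u v → ∃[ k ] Walk u v k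

  Dist : Fin (n G) → Fin (n G) → ℕ → Set
  Dist u v k = Walk u v k × (∀ m → Walk u v m → k ≤ m)

  Separates : Fin (n G) → Fin (n G) → Fin (n G) → Set
  Separates x v w = ∃[ k ] ∃[ l ] (Dist v x k × Dist w x l × k ≢ l)

  Resolving : Subset (n G) → Set
  Resolving S = ∀ v w → v ≢ w → ∃[ x ] (x ∈ S × Separates x v w)

  Dominating : Subset (n G) → Set
  Dominating S = ∀ v → v ∉ S → ∃[ w ] (w ∈ S × Adj G v w)

  HasRDSetOfSize : ℕ → Set
  HasRDSetOfSize k = ∃[ S ] (Resolving S × Dominating S × ∣ S ∣ ≡ k)

  EtaIs : ℕ → Set
  EtaIs b = HasRDSetOfSize b × (∀ k → HasRDSetOfSize k → b ≤ k)

  -- A partition into k (nonempty) classes S_0,…,S_{k-1}: class map c, surjective.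
  IsPartition : (k : ℕ) → (Fin (n G) → Fin k) → Set
  IsPartition k c = ∀ (j : Fin k) → ∃[ v ] (c v ≡ j)

  DistToClass : ∀ {k} → (Fin (n G) → Fin k) → Fin (n G) → Fin k → ℕ → Set
  DistToClass c v j m =
    (∃[ w ] (c w ≡ j × Dist v w m)) × (∀ w m' → c w ≡ j → Dist v w m' → m ≤ m')

  ResolvingPartition : ∀ k → (Fin (n G) → Fin k) → Set
  ResolvingPartition k c = ∀ u v → u ≢ v →
    ∃[ j ] ∃[ p ] ∃[ q ] (DistToClass c u j p × DistToClass c v j q × p ≢ q)

  DominatingPartition : ∀ k → (Fin (n G) → Fin k) → Set
  DominatingPartition k c = ∀ v → ∃[ j ] DistToClass c v j 1

  HasRDPartitionOfSize : ℕ → Set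
  HasRDPartitionOfSize k = ∃[ c ] (IsPartition k c × ResolvingPartition k c × DominatingPartition k c)

  EtaPIs : ℕ → Set
  EtaPIs a = HasRDPartitionOfSize a × (∀ k → HasRDPartitionOfSize k → a ≤ k)

module Submission where

-- All witnesses belong to one family (module Ladder): a hub carrying pendant leaves and a
-- root, followed by a ladder of levels, each a pair of adjacent twin rungs.
-- Lower bounds come from twins, vertices with the same neighbours apart from each other:
-- they are equidistant from every third vertex, so a resolving set contains one of them
-- and a resolving partition puts them in different classes. Pendant vertices on one hub
-- are twins; moreover a dominating set missing a pendant contains its hub, and a
-- dominating partition never puts a pendant in its hub's class.
-- Upper bounds come from a landmark: the distances to the leaf t₀, read off a distance
-- labelling, separate all vertices outside the chosen set (resp. inside each class).

open import Defs
open import Data.Bool using (Bool; true; false; not)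
open import Data.Empty using (⊥-elim)
open import Data.Fin using (Fin; zero; suc; toℕ; inject₁; splitAt; join; _↑ˡ_; _↑ʳ_)
open import Data.Fin.Properties using (_≟_; any?; injective⇒≤; suc-injective; toℕ-injective; toℕ-inject₁; splitAt-↑ˡ; splitAt-↑ʳ; join-splitAt)
open import Data.Fin.Subset using (Subset; _∈_; _∉_; ∣_∣; _-_) renaming (⊤ to full; ⊥ to empty)
open import Data.Fin.Subset.Properties using (_∈?_; x∈p∧x≢y⇒x∈p-y; x∈p⇒∣p-x∣<∣p∣; ∣⊤∣≡n; ∣⊥∣≡0)
open import Data.Nat using (ℕ; zero; suc; _+_; _≤_; _<_; z≤n; s≤s)
open import Data.Nat.Properties using (≤-refl; ≤-trans; ≤-antisym; ≤-reflexive; ≤-<-trans; ≤-pred; n≤1+n; 1+n≢n; ≮⇒≥; m<1+n⇒m<n∨m≡n; +-comm; +-suc; +-identityʳ; +-cancelˡ-≡; m≤n⇒∃[o]m+o≡n) renaming (_≟_ to _≟ℕ_; suc-injective to ℕ-suc-injective)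
open import Data.Product using (∃-syntax; _×_; _,_; proj₁; proj₂)
open import Data.Sum using (_⊎_; inj₁; inj₂; [_,_]′)
open import Data.Vec using (_∷_; []; _++_; lookup)
open import Data.Vec.Properties using (lookup-++ˡ; lookup-++ʳ; lookup-replicate; lookup⇒[]=)
open import Function using (_∘_)
open import Relation.Nullary using (¬_; Dec; yes; no; ¬?)
open import Relation.Nullary.Decidable using (_×-dec_; _⊎-dec_; map′)
open import Relation.Binary.PropositionalEquality using (_≡_; _≢_; refl; trans; cong; cong₂; subst; subst₂) renaming (sym to ≡-sym)

-- A decidable predicate on ℕ that holds somewhere has a least witness; this is how
-- distances (least walk lengths) are shown to exist.
module _ {P : ℕ → Set} (P? : ∀ k → Dec (P k)) where

  Least : ℕ → Set
  Least k = P k × (∀ j → P j → k ≤ j)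

  private
    search : ∀ n → ∃[ k ] Least k ⊎ (∀ j → j < n → ¬ P j)
    search zero = inj₂ (λ _ ())
    search (suc n) with search n
    ... | inj₁ least = inj₁ least
    ... | inj₂ none with P? n
    ...   | yes pn = inj₁ (n , pn , λ j pj → ≮⇒≥ (λ j<n → none j j<n pj))
    ...   | no ¬pn = inj₂ below
      where
      below : ∀ j → j < suc n → ¬ P j
      below j j<1+n with m<1+n⇒m<n∨m≡n j<1+n
      ... | inj₁ j<n = none j j<n
      ... | inj₂ refl = ¬pn

  least-witness : ∀ {K} → P K → ∃[ k ] Least k
  least-witness {K} pK with search (suc K)
  ... | inj₁ least = least
  ... | inj₂ none = ⊥-elim (none K ≤-refl pK)

-- If k pairwise disjoint blocks of vertices each meet S, then S has at least k elements:
-- picking one member of S in each block gives an injective family of members.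
disjoint-blocks≤∣S∣ : ∀ {n k} (S : Subset n) (B : Fin k → Fin n → Set) →
  (∀ {i j v} → B i v → B j v → i ≡ j) → (∀ i → ∃[ v ] (v ∈ S × B i v)) → k ≤ ∣ S ∣
disjoint-blocks≤∣S∣ {k = k} S B disjoint meets =
  members≤∣S∣ k S pick (λ {i} {j} e → disjoint (inBlock i) (subst (B j) (≡-sym e) (inBlock j)))
    (λ i → proj₁ (proj₂ (meets i)))
  where
  pick : Fin k → Fin _
  pick i = proj₁ (meets i)
  inBlock : ∀ i → B i (pick i)
  inBlock i = proj₂ (proj₂ (meets i))
  members≤∣S∣ : ∀ {n} k (S : Subset n) (f : Fin k → Fin n) →
    (∀ {i j} → f i ≡ f j → i ≡ j) → (∀ i → f i ∈ S) → k ≤ ∣ S ∣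
  members≤∣S∣ zero S f inj mem = z≤n
  members≤∣S∣ (suc k) S f inj mem =
    ≤-<-trans (members≤∣S∣ k (S - f zero) (λ i → f (suc i)) (λ e → suc-injective (inj e))
                 (λ i → x∈p∧x≢y⇒x∈p-y (mem (suc i)) (λ e → suc≢zero (inj e))))
              (x∈p⇒∣p-x∣<∣p∣ (mem zero))
    where
    suc≢zero : ∀ {k} {i : Fin k} → suc i ≢ zero
    suc≢zero ()

module GraphTheory (G : Graph) (adj? : ∀ u v → Dec (Adj G u v)) where

  V : Set
  V = Fin (n G)

  _++ʷ_ : ∀ {u v w k l} → Walk G u v k → Walk G v w l → Walk G u w (k + l)
  here ++ʷ q = q
  step a p ++ʷ q = step a (p ++ʷ q)

  reverseʷ : ∀ {u v k} → Walk G u v k → Walk G v u k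
  reverseʷ {k = k} p = subst (Walk G _ _) (+-identityʳ k) (go p here)
    where
    go : ∀ {u v w k l} → Walk G u v k → Walk G u w l → Walk G v w (k + l)
    go here acc = acc
    go {k = suc k} {l} (step a p) acc = subst (Walk G _ _) (+-suc k l) (go p (step (sym G a) acc))

  walk? : ∀ k u w → Dec (Walk G u w k)
  walk? zero u w with u ≟ w
  ... | yes refl = yes here
  ... | no u≢w = no λ { here → u≢w refl }
  walk? (suc k) u w with any? (λ v → adj? u v ×-dec walk? k v w)
  ... | yes (v , a , p) = yes (step a p)
  ... | no none = no λ { (step a p) → none (_ , a , p) }

  dist-exists : ∀ {u w K} → Walk G u w K → ∃[ k ] Dist G u w k
  dist-exists {u} {w} = least-witness (λ k → walk? k u w)

  dist-unique : ∀ {u w k l} → Dist G u w k → Dist G u w l → k ≡ l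
  dist-unique (p , min-p) (q , min-q) = ≤-antisym (min-p _ q) (min-q _ p)

  dist-refl : ∀ {u} → Dist G u u 0
  dist-refl = here , λ _ _ → z≤n

  dist0 : ∀ {u w} → Dist G u w 0 → u ≡ w
  dist0 (here , _) = refl

  dist1 : ∀ {u w} → Dist G u w 1 → Adj G u w
  dist1 (step a here , _) = a

  dist-adj : ∀ {u w} → Adj G u w → Dist G u w 1
  dist-adj {u} a = step a here , positive
    where
    positive : ∀ m → Walk G u _ m → 1 ≤ m
    positive zero here = ⊥-elim (irrefl G a)
    positive (suc m) _ = s≤s z≤n

  record DistanceLabelling (t : V) (f : V → ℕ) : Set where
    field
      at-target    : f t ≡ 0
      zero-only-at : ∀ u → f u ≡ 0 → u ≡ t
      lipschitz    : ∀ {u w} → Adj G u w → f u ≤ suc (f w)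
      descent      : ∀ u {k} → f u ≡ suc k → ∃[ w ] (Adj G u w × f w ≡ k)

  -- Such a labelling computes distances: descending gives a walk of length f u to t,
  -- and the Lipschitz bound shows that no walk is shorter.
  module _ {t f} (L : DistanceLabelling t f) where
    open DistanceLabelling L

    labelling-walk : ∀ k u → f u ≡ k → Walk G u t k
    labelling-walk zero u e = subst (λ v → Walk G v t 0) (≡-sym (zero-only-at u e)) here
    labelling-walk (suc k) u e with descent u e
    ... | w , a , e′ = step a (labelling-walk k w e′)

    labelling-dist : ∀ u → Dist G u t (f u)
    labelling-dist u = labelling-walk (f u) u refl , λ _ → lower
      where
      lower : ∀ {u m} → Walk G u t m → f u ≤ m
      lower here = ≤-reflexive at-target
      lower (step a p) = ≤-trans (lipschitz a) (s≤s (lower p))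

    labelling-connected : Connected G
    labelling-connected u w = _ , (labelling-walk (f u) u refl ++ʷ reverseʷ (labelling-walk (f w) w refl))

  NeighboursShared : V → V → Set
  NeighboursShared u w = ∀ z → z ≢ u → z ≢ w → Adj G u z → Adj G w z

  Twins : V → V → Set
  Twins u w = NeighboursShared u w × NeighboursShared w u

  shared-walk : ∀ {u w z k} → NeighboursShared u w → z ≢ u → z ≢ w →
    Walk G u z k → ∃[ k′ ] (k′ ≤ k × Walk G w z k′)
  shared-walk sh z≢u z≢w here = ⊥-elim (z≢u refl)
  shared-walk {u} {w} {k = suc k} sh z≢u z≢w (step {v = y} a p) with y ≟ w
  ... | yes refl = k , n≤1+n k , p
  ... | no y≢w = suc k , ≤-refl , step (sh y (λ { refl → irrefl G a }) y≢w a) p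

  twins-equidistant : ∀ {u w z k l} → Twins u w → z ≢ u → z ≢ w →
    Dist G u z k → Dist G w z l → k ≡ l
  twins-equidistant (uw , wu) z≢u z≢w (p , min-p) (q , min-q) =
    ≤-antisym (shorter wu z≢w z≢u q min-p) (shorter uw z≢u z≢w p min-q)
    where
    shorter : ∀ {u w z k l} → NeighboursShared u w → z ≢ u → z ≢ w →
      Walk G u z k → (∀ m → Walk G w z m → l ≤ m) → l ≤ k
    shorter sh z≢u z≢w p min with shared-walk sh z≢u z≢w p
    ... | k′ , k′≤k , p′ = ≤-trans (min k′ p′) k′≤k

  -- Only a twin itself can tell two twins apart, so a resolving set contains one of them.
  resolving-contains-twin : ∀ {S u w} → Resolving G S → u ≢ w → Twins u w → u ∈ S ⊎ w ∈ S
  resolving-contains-twin {S} {u} {w} res u≢w tw with res u w u≢w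
  ... | x , x∈S , k , l , du , dw , k≢l with x ≟ u | x ≟ w
  ...   | yes refl | _ = inj₁ x∈S
  ...   | no _ | yes refl = inj₂ x∈S
  ...   | no x≢u | no x≢w = ⊥-elim (k≢l (twins-equidistant tw x≢u x≢w du dw))

  Pendant : V → V → Set
  Pendant t h = ∀ z → Adj G t z → z ≡ h

  pendants-twins : ∀ {t t′ h} → Pendant t h → Pendant t′ h → Adj G t h → Adj G t′ h → Twins t t′
  pendants-twins pt pt′ th t′h = shared pt t′h , shared pt′ th
    where
    shared : ∀ {t t′ h} → Pendant t h → Adj G t′ h → NeighboursShared t t′
    shared pt t′h z _ _ a with pt z a
    ... | refl = t′h

  dominating-contains-hub : ∀ {S t h} → Dominating G S → Pendant t h → t ∉ S → h ∈ S
  dominating-contains-hub dom pt t∉S with dom _ t∉S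
  ... | z , z∈S , a with pt z a
  ...   | refl = z∈S

  module Connectedness (conn : Connected G) where

    distance : ∀ u w → ∃[ k ] Dist G u w k
    distance u w = dist-exists (proj₂ (conn u w))

    -- A vertex in S separates itself from every other vertex (distance 0 versus positive).
    separated-by-member : ∀ {S u w} → u ≢ w → u ∈ S ⊎ w ∈ S → ∃[ x ] (x ∈ S × Separates G x u w)
    separated-by-member {u = u} {w} u≢w (inj₁ u∈S) with distance w u
    ... | zero , d = ⊥-elim (u≢w (≡-sym (dist0 d)))
    ... | suc l , d = u , u∈S , 0 , suc l , dist-refl , d , λ ()
    separated-by-member {u = u} {w} u≢w (inj₂ w∈S) with distance u w
    ... | zero , d = ⊥-elim (u≢w (dist0 d))
    ... | suc k , d = w , w∈S , suc k , 0 , d , dist-refl , λ ()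

    landmark-resolving : ∀ {S t} (f : V → ℕ) → t ∈ S → (∀ u → Dist G u t (f u)) →
      (∀ {u w} → u ∉ S → w ∉ S → f u ≡ f w → u ≡ w) → Resolving G S
    landmark-resolving {S} {t} f t∈S d injective u w u≢w with u ∈? S | w ∈? S
    ... | yes u∈S | _ = separated-by-member u≢w (inj₁ u∈S)
    ... | no _ | yes w∈S = separated-by-member u≢w (inj₂ w∈S)
    ... | no u∉S | no w∉S = t , t∈S , f u , f w , d u , d w , λ e → u≢w (injective u∉S w∉S e)

    module Classes {K} (c : V → Fin K) where

      ClassDist : V → Fin K → ℕ → Set
      ClassDist = DistToClass G c

      class-dist-exists : ∀ v j w → c w ≡ j → ∃[ m ] ClassDist v j m
      class-dist-exists v j w cw with least-witness Q? (w , cw , proj₂ (conn v w))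
        where
        Q : ℕ → Set
        Q k = ∃[ z ] (c z ≡ j × Walk G v z k)
        Q? : ∀ k → Dec (Q k)
        Q? k = any? (λ z → (c z ≟ j) ×-dec walk? k v z)
      ... | k , (z , cz , p) , min =
        k , (z , cz , p , λ m q → min m (z , cz , q)) , λ z′ m′ cz′ d → min m′ (z′ , cz′ , proj₁ d)

      class-dist0 : ∀ {v j} → ClassDist v j 0 → c v ≡ j
      class-dist0 ((z , cz , d) , _) with dist0 d
      ... | refl = cz

      class-dist-self : ∀ {v} → ClassDist v (c v) 0
      class-dist-self {v} = (v , refl , dist-refl) , λ _ _ _ _ → z≤n

      class-dist-adj : ∀ {v z} → c v ≢ c z → Adj G v z → ClassDist v (c z) 1
      class-dist-adj {v} {z} cv≢cz a = (z , refl , dist-adj a) , positive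
        where
        positive : ∀ w m → c w ≡ c z → Dist G v w m → 1 ≤ m
        positive w zero cw d with dist0 d
        ... | refl = ⊥-elim (cv≢cz cw)
        positive w (suc m) _ _ = s≤s z≤n

      class-dist-singleton : ∀ {v t k} → (∀ w → c w ≡ c t → w ≡ t) → Dist G v t k → ClassDist v (c t) k
      class-dist-singleton {v} {t} only d = (t , refl , d) , λ w m cw dw →
        ≤-reflexive (dist-unique d (subst (λ z → Dist G v z m) (only w cw) dw))

      -- Vertices in different classes are told apart by the class of the first one.
      distinct-classes-separated : ∀ {u w} → c u ≢ c w →
        ∃[ j ] ∃[ p ] ∃[ q ] (ClassDist u j p × ClassDist w j q × p ≢ q)
      distinct-classes-separated {u} {w} cu≢cw with class-dist-exists w (c u) u refl
      ... | zero , d = ⊥-elim (cu≢cw (≡-sym (class-dist0 d)))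
      ... | suc q , d = c u , 0 , suc q , class-dist-self , d , λ ()

      landmark-resolving-partition : ∀ {t} (f : V → ℕ) → (∀ w → c w ≡ c t → w ≡ t) →
        (∀ u → Dist G u t (f u)) → (∀ {u w} → c u ≡ c w → f u ≡ f w → u ≡ w) →
        ResolvingPartition G K c
      landmark-resolving-partition f only d injective u w u≢w with c u ≟ c w
      ... | no cu≢cw = distinct-classes-separated cu≢cw
      ... | yes cu≡cw = _ , f u , f w , class-dist-singleton only (d u) , class-dist-singleton only (d w) ,
                        λ e → u≢w (injective cu≡cw e)

      dominating-by-neighbours : (∀ u → ∃[ w ] (Adj G u w × c u ≢ c w)) → DominatingPartition G K c
      dominating-by-neighbours nb u with nb u
      ... | w , a , cu≢cw = c w , class-dist-adj cu≢cw a

      -- Twins lie in distinct classes of a resolving partition: a class is no closer to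
      -- one twin than to the other.
      partition-separates-twins : ∀ {u w} → ResolvingPartition G K c → u ≢ w → Twins u w → c u ≢ c w
      partition-separates-twins {u} {w} res u≢w (uw , wu) cu≡cw with res u w u≢w
      ... | j , p , q , du , dw , p≢q =
        p≢q (≤-antisym (no-closer wu (≡-sym cu≡cw) dw du) (no-closer uw cu≡cw du dw))
        where
        no-closer : ∀ {u w p q} → NeighboursShared u w → c u ≡ c w →
          ClassDist u j p → ClassDist w j q → q ≤ p
        no-closer {u} {w} sh cu≡cw ((z , cz , dz) , _) (_ , min) with z ≟ u | z ≟ w
        ... | yes refl | _ = ≤-trans (min w 0 (trans (≡-sym cu≡cw) cz) dist-refl) z≤n
        ... | no _ | yes refl = ≤-trans (min w 0 cz dist-refl) z≤n
        ... | no z≢u | no z≢w with shared-walk sh z≢u z≢w (proj₁ dz)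
        ...   | k′ , k′≤p , p′ with dist-exists p′
        ...     | d , dd = ≤-trans (min z d cz dd) (≤-trans (proj₂ dd k′ p′) k′≤p)

      -- A pendant vertex is dominated only by its hub, which therefore lies in another class.
      pendant-class-differs : ∀ {t h} → DominatingPartition G K c → Pendant t h → c t ≢ c h
      pendant-class-differs {t} dom pt ct≡ch with dom t
      ... | j , (z , cz , d) , min with pt z (dist1 d)
      ...   | refl with min t 0 (trans ct≡ch cz) dist-refl
      ...     | ()

    -- k pendant vertices on a common hub need at least k + 1 classes in a resolving
    -- dominating partition: they are pairwise twins, and none shares the hub's class.
    pendants-partition-bound : ∀ {k h} (ℓ : Fin k → V) → (∀ {i j} → ℓ i ≡ ℓ j → i ≡ j) →
      (∀ i → Pendant (ℓ i) h) → (∀ i → Adj G (ℓ i) h) → ∀ K → HasRDPartitionOfSize G K → suc k ≤ K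
    pendants-partition-bound {k} {h} ℓ ℓ-inj pend adj K (c , _ , res , dom) =
      injective⇒≤ {f = class} class-injective
      where
      open Classes c
      class : Fin (suc k) → Fin K
      class zero = c h
      class (suc i) = c (ℓ i)
      class-injective : ∀ {x y} → class x ≡ class y → x ≡ y
      class-injective {zero} {zero} _ = refl
      class-injective {zero} {suc j} e = ⊥-elim (pendant-class-differs dom (pend j) (≡-sym e))
      class-injective {suc i} {zero} e = ⊥-elim (pendant-class-differs dom (pend i) e)
      class-injective {suc i} {suc j} e with i ≟ j
      ... | yes i≡j = cong suc i≡j
      ... | no i≢j = ⊥-elim (partition-separates-twins res (λ q → i≢j (ℓ-inj q))
                                 (pendants-twins (pend i) (pend j) (adj i) (adj j)) e)

    singleton-partition : (∀ u → ∃[ w ] Adj G u w) → HasRDPartitionOfSize G (n G)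
    singleton-partition nb = (λ u → u) , (λ j → j , refl) , (λ u w u≢w → distinct-classes-separated u≢w) ,
      dominating-by-neighbours neighbour-elsewhere
      where
      open Classes (λ u → u)
      neighbour-elsewhere : ∀ u → ∃[ w ] (Adj G u w × u ≢ w)
      neighbour-elsewhere u with nb u
      ... | w , a = w , a , λ { refl → irrefl G a }

-- The graph on 2 + m + 2p vertices, m = m′ + 1: a hub with m pendant leaves t₀, …, t_{m′}
-- and one further neighbour, the root, which starts a ladder of p levels each holding a
-- pair of adjacent twin rungs x_i, y_i.
module Ladder (m′ p : ℕ) where

  m : ℕ
  m = suc m′

  data Vtx : Set where
    hub root : Vtx
    leaf     : Fin m → Vtx
    rung     : Fin p → Bool → Vtx

  level : Vtx → ℕ
  level (leaf _)   = 0
  level hub        = 1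
  level root       = 2
  level (rung i _) = 3 + toℕ i

  data IsRung : Vtx → Set where
    is-rung : ∀ i s → IsRung (rung i s)

  Adjacent : Vtx → Vtx → Set
  Adjacent a b = suc (level a) ≡ level b ⊎ suc (level b) ≡ level a ⊎
                 (IsRung a × IsRung b × level a ≡ level b × a ≢ b)

  adjacent-sym : ∀ {a b} → Adjacent a b → Adjacent b a
  adjacent-sym (inj₁ e) = inj₂ (inj₁ e)
  adjacent-sym (inj₂ (inj₁ e)) = inj₁ e
  adjacent-sym (inj₂ (inj₂ (ra , rb , e , a≢b))) = inj₂ (inj₂ (rb , ra , ≡-sym e , λ e′ → a≢b (≡-sym e′)))

  adjacent-irrefl : ∀ {a} → ¬ Adjacent a a
  adjacent-irrefl (inj₁ e) = 1+n≢n e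
  adjacent-irrefl (inj₂ (inj₁ e)) = 1+n≢n e
  adjacent-irrefl (inj₂ (inj₂ (_ , _ , _ , a≢a))) = a≢a refl

  -- Vertices are numbered hub, root, leaves, rungs x_i (side true), rungs y_i (side false).
  N : ℕ
  N = suc (suc (m + (p + p)))

  encode : Vtx → Fin N
  encode hub            = zero
  encode root           = suc zero
  encode (leaf j)       = suc (suc (j ↑ˡ (p + p)))
  encode (rung i true)  = suc (suc (m ↑ʳ (i ↑ˡ p)))
  encode (rung i false) = suc (suc (m ↑ʳ (p ↑ʳ i)))

  rungAt : Fin p ⊎ Fin p → Vtx
  rungAt = [ (λ i → rung i true) , (λ i → rung i false) ]′

  afterRoot : Fin m ⊎ Fin (p + p) → Vtx
  afterRoot = [ leaf , rungAt ∘ splitAt p ]′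

  decode : Fin N → Vtx
  decode zero          = hub
  decode (suc zero)    = root
  decode (suc (suc i)) = afterRoot (splitAt m i)

  decode-encode : ∀ a → decode (encode a) ≡ a
  decode-encode hub = refl
  decode-encode root = refl
  decode-encode (leaf j) rewrite splitAt-↑ˡ m j (p + p) = refl
  decode-encode (rung i true) rewrite splitAt-↑ʳ m (p + p) (i ↑ˡ p) | splitAt-↑ˡ p i p = refl
  decode-encode (rung i false) rewrite splitAt-↑ʳ m (p + p) (p ↑ʳ i) | splitAt-↑ʳ p p i = refl

  encode-decode : ∀ u → encode (decode u) ≡ u
  encode-decode zero = refl
  encode-decode (suc zero) = refl
  encode-decode (suc (suc i)) = encode-afterRoot (splitAt m i) (join-splitAt m (p + p) i)
    where
    encode-rungAt : ∀ s {r} → join p p s ≡ r → encode (rungAt s) ≡ suc (suc (m ↑ʳ r))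
    encode-rungAt (inj₁ _) refl = refl
    encode-rungAt (inj₂ _) refl = refl
    encode-afterRoot : ∀ s {i} → join m (p + p) s ≡ i → encode (afterRoot s) ≡ suc (suc i)
    encode-afterRoot (inj₁ _) refl = refl
    encode-afterRoot (inj₂ r) refl = encode-rungAt (splitAt p r) (join-splitAt p p r)

  encode-injective : ∀ {a b} → encode a ≡ encode b → a ≡ b
  encode-injective {a} {b} e = trans (≡-sym (decode-encode a)) (trans (cong decode e) (decode-encode b))

  decode-injective : ∀ {u w} → decode u ≡ decode w → u ≡ w
  decode-injective {u} {w} e = trans (≡-sym (encode-decode u)) (trans (cong encode e) (encode-decode w))

  _≟ᵥ_ : ∀ (a b : Vtx) → Dec (a ≡ b)
  a ≟ᵥ b = map′ encode-injective (cong encode) (encode a ≟ encode b)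

  is-rung? : ∀ a → Dec (IsRung a)
  is-rung? (rung i s) = yes (is-rung i s)
  is-rung? hub = no λ ()
  is-rung? root = no λ ()
  is-rung? (leaf _) = no λ ()

  adjacent? : ∀ a b → Dec (Adjacent a b)
  adjacent? a b = (suc (level a) ≟ℕ level b) ⊎-dec (suc (level b) ≟ℕ level a) ⊎-dec
    (is-rung? a ×-dec is-rung? b ×-dec (level a ≟ℕ level b) ×-dec ¬? (a ≟ᵥ b))

  graph : Graph
  graph = record
    { n = N ; Adj = λ u w → Adjacent (decode u) (decode w) ; sym = adjacent-sym ; irrefl = adjacent-irrefl }

  open GraphTheory graph (λ u w → adjacent? (decode u) (decode w)) public

  adj-encode : ∀ {a b} → Adjacent a b → Adj graph (encode a) (encode b)
  adj-encode {a} {b} = subst₂ Adjacent (≡-sym (decode-encode a)) (≡-sym (decode-encode b))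

  adj-decode : ∀ {a u} → Adj graph (encode a) u → Adjacent a (decode u)
  adj-decode {a} {u} = subst (λ x → Adjacent x (decode u)) (decode-encode a)

  shared-encode : ∀ {a b} → (∀ c → c ≢ b → Adjacent a c → Adjacent b c) →
    NeighboursShared (encode a) (encode b)
  shared-encode {a} {b} sh z _ z≢b adj =
    subst (λ x → Adjacent x (decode z)) (≡-sym (decode-encode b))
      (sh (decode z) (λ e → z≢b (trans (≡-sym (encode-decode z)) (cong encode e))) (adj-decode {a} {z} adj))

  adj-encodeʳ : ∀ u {b} → Adjacent (decode u) b → Adj graph u (encode b)
  adj-encodeʳ u {b} = subst (Adjacent (decode u)) (≡-sym (decode-encode b))

  pendant-encode : ∀ {a} → (∀ c → Adjacent a c → c ≡ hub) → Pendant (encode a) (encode hub)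
  pendant-encode pend z adj =
    trans (≡-sym (encode-decode z)) (cong encode (pend (decode z) (adj-decode {u = z} adj)))

  -- The hub is the only vertex of level one, so the leaves are pendant on it.
  level-one : ∀ c → level c ≡ 1 → c ≡ hub
  level-one hub _ = refl
  level-one root ()
  level-one (leaf _) ()
  level-one (rung _ _) ()

  leaf-pendant : ∀ j c → Adjacent (leaf j) c → c ≡ hub
  leaf-pendant j c (inj₁ e) = level-one c (≡-sym e)
  leaf-pendant j c (inj₂ (inj₁ ()))
  leaf-pendant j c (inj₂ (inj₂ (() , _)))

  -- The two rungs of a level are twins: adjacency to any third vertex only depends on
  -- its level and on being a rung.
  rungs-shared : ∀ i s s′ c → c ≢ rung i s′ → Adjacent (rung i s) c → Adjacent (rung i s′) c
  rungs-shared i s s′ c _ (inj₁ e) = inj₁ e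
  rungs-shared i s s′ c _ (inj₂ (inj₁ e)) = inj₂ (inj₁ e)
  rungs-shared i s s′ c c≢r (inj₂ (inj₂ (_ , rc , e , _))) =
    inj₂ (inj₂ (is-rung i s′ , rc , e , λ e′ → c≢r (≡-sym e′)))

  rung-partner : ∀ i s → Adjacent (rung i s) (rung i (not s))
  rung-partner i true  = inj₂ (inj₂ (is-rung i true , is-rung i false , refl , λ ()))
  rung-partner i false = inj₂ (inj₂ (is-rung i false , is-rung i true , refl , λ ()))

  rungs-twins : ∀ i → Twins (encode (rung i true)) (encode (rung i false))
  rungs-twins i = shared-encode (rungs-shared i true false) , shared-encode (rungs-shared i false true)

  -- pot a is the distance from a to the leaf t₀: the level, except 2 for the other leaves.
  pot : Vtx → ℕ
  pot (leaf zero)    = 0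
  pot (leaf (suc _)) = 2
  pot hub            = 1
  pot root           = 2
  pot (rung i _)     = 3 + toℕ i

  pot-zero : ∀ a → pot a ≡ 0 → a ≡ leaf zero
  pot-zero (leaf zero) _ = refl
  pot-zero (leaf (suc _)) ()
  pot-zero hub ()
  pot-zero root ()
  pot-zero (rung _ _) ()

  adjacent-levels : ∀ {a b} → Adjacent a b → level a ≤ suc (level b)
  adjacent-levels (inj₁ e) = ≤-trans (n≤1+n _) (≤-trans (≤-reflexive e) (n≤1+n _))
  adjacent-levels (inj₂ (inj₁ e)) = ≤-reflexive (≡-sym e)
  adjacent-levels (inj₂ (inj₂ (_ , _ , e , _))) = ≤-trans (≤-reflexive e) (n≤1+n _)

  pot-lipschitz : ∀ a b → Adjacent a b → pot a ≤ suc (pot b)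
  pot-lipschitz (leaf zero) b _ = z≤n
  pot-lipschitz (leaf (suc j)) b adj with leaf-pendant (suc j) b adj
  ... | refl = ≤-refl
  pot-lipschitz hub b _ = s≤s z≤n
  pot-lipschitz root (leaf j) adj with leaf-pendant j root (adjacent-sym adj)
  ... | ()
  pot-lipschitz (rung i s) (leaf j) adj with leaf-pendant j (rung i s) (adjacent-sym adj)
  ... | ()
  pot-lipschitz root hub adj = adjacent-levels adj
  pot-lipschitz root root adj = adjacent-levels adj
  pot-lipschitz root (rung _ _) adj = adjacent-levels adj
  pot-lipschitz (rung _ _) hub adj = adjacent-levels adj
  pot-lipschitz (rung _ _) root adj = adjacent-levels adj
  pot-lipschitz (rung _ _) (rung _ _) adj = adjacent-levels adj

  pot-descent : ∀ a {k} → pot a ≡ suc k → ∃[ b ] (Adjacent a b × pot b ≡ k)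
  pot-descent (leaf zero) ()
  pot-descent (leaf (suc _)) refl = hub , inj₁ refl , refl
  pot-descent hub refl = leaf zero , inj₂ (inj₁ refl) , refl
  pot-descent root refl = hub , inj₂ (inj₁ refl) , refl
  pot-descent (rung zero s) refl = root , inj₂ (inj₁ refl) , refl
  pot-descent (rung (suc i) s) refl =
    rung (inject₁ i) s , inj₂ (inj₁ (cong (λ x → 4 + x) (toℕ-inject₁ i))) , cong (3 +_) (toℕ-inject₁ i)

  t₀ : Fin N
  t₀ = encode (leaf zero)

  potential : Fin N → ℕ
  potential u = pot (decode u)

  pot-labelling : DistanceLabelling t₀ potential
  pot-labelling = record
    { at-target    = cong pot (decode-encode (leaf zero))
    ; zero-only-at = λ u e → trans (≡-sym (encode-decode u)) (cong encode (pot-zero (decode u) e))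
    ; lipschitz    = λ {u} {w} → pot-lipschitz (decode u) (decode w)
    ; descent      = descent
    }
    where
    descent : ∀ u {k} → potential u ≡ suc k → ∃[ w ] (Adj graph u w × potential w ≡ k)
    descent u e with pot-descent (decode u) e
    ... | b , adj , e′ = encode b , adj-encodeʳ u adj , trans (cong pot (decode-encode b)) e′

  dist-to-t₀ : ∀ u → Dist graph u t₀ (potential u)
  dist-to-t₀ = labelling-dist pot-labelling

  connected : Connected graph
  connected = labelling-connected pot-labelling

  open Connectedness connected public

  has-neighbour : ∀ a → ∃[ b ] Adjacent a b
  has-neighbour (leaf _)   = hub , inj₁ refl
  has-neighbour hub        = leaf zero , inj₂ (inj₁ refl)
  has-neighbour root       = hub , inj₂ (inj₁ refl)
  has-neighbour (rung i s) = rung i (not s) , rung-partner i s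

  neighbour : ∀ u → ∃[ w ] Adj graph u w
  neighbour u with has-neighbour (decode u)
  ... | b , adj = encode b , adj-encodeʳ u adj

  -- A Vtx-level pendant vertex is adjacent to the hub, as every vertex has a neighbour.
  pendant-adj-hub : ∀ {a} → (∀ c → Adjacent a c → c ≡ hub) → Adjacent a hub
  pendant-adj-hub {a} pend with has-neighbour a
  ... | b , adj with pend b adj
  ...   | refl = adj

  partition-bound : ∀ {k} (φ : Fin k → Vtx) → (∀ {i j} → φ i ≡ φ j → i ≡ j) →
    (∀ i c → Adjacent (φ i) c → c ≡ hub) → ∀ K → HasRDPartitionOfSize graph K → suc k ≤ K
  partition-bound φ φ-inj pend = pendants-partition-bound (encode ∘ φ) (λ e → φ-inj (encode-injective e))
    (λ i → pendant-encode (pend i)) (λ i → adj-encode (pendant-adj-hub (pend i)))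

  -- A resolving dominating set has at least k + p elements whenever φ lists k distinct
  -- pendant vertices on the hub: each pendant contributes itself or, when it is missing,
  -- the hub (which happens for at most one pendant, since pendants are pairwise twins),
  -- and each level of the ladder contributes one of its twin rungs.
  set-bound : ∀ {k} (φ : Fin k → Vtx) → (∀ {i j} → φ i ≡ φ j → i ≡ j) →
    (∀ i c → Adjacent (φ i) c → c ≡ hub) → ∀ K → HasRDSetOfSize graph K → k + p ≤ K
  set-bound {k} φ φ-inj pend _ (S , res , dom , refl) =
    disjoint-blocks≤∣S∣ S Block′ (λ {β} {β′} {u} → disjoint′ {β} {β′} {u}) meets′
    where
    φ≢hub : ∀ i → φ i ≢ hub
    φ≢hub i e with pend i (leaf zero) (subst (λ x → Adjacent x (leaf zero)) (≡-sym e) (inj₂ (inj₁ refl)))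
    ... | ()

    φ≢rung : ∀ i {j s} → φ i ≢ rung j s
    φ≢rung i {j} {s} e
      with pend i (rung j (not s)) (subst (λ x → Adjacent x (rung j (not s))) (≡-sym e) (rung-partner j s))
    ... | ()

    φ-twins : ∀ i j → Twins (encode (φ i)) (encode (φ j))
    φ-twins i j = pendants-twins (pendant-encode (pend i)) (pendant-encode (pend j))
      (adj-encode (pendant-adj-hub (pend i))) (adj-encode (pendant-adj-hub (pend j)))

    Block : Fin k ⊎ Fin p → Vtx → Set
    Block (inj₁ i) a = a ≡ φ i ⊎ (a ≡ hub × encode (φ i) ∉ S)
    Block (inj₂ j) a = ∃[ s ] (a ≡ rung j s)

    disjoint : ∀ {β β′ a} → Block β a → Block β′ a → β ≡ β′
    disjoint {inj₁ i} {inj₁ j} (inj₁ refl) (inj₁ e) = cong inj₁ (φ-inj e)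
    disjoint {inj₁ i} {inj₁ j} (inj₁ refl) (inj₂ (e , _)) = ⊥-elim (φ≢hub i e)
    disjoint {inj₁ i} {inj₁ j} (inj₂ (refl , _)) (inj₁ e) = ⊥-elim (φ≢hub j (≡-sym e))
    disjoint {inj₁ i} {inj₁ j} (inj₂ (_ , i∉S)) (inj₂ (_ , j∉S)) with i ≟ j
    ... | yes i≡j = cong inj₁ i≡j
    ... | no i≢j = ⊥-elim ([ i∉S , j∉S ]′
                     (resolving-contains-twin res (λ e → i≢j (φ-inj (encode-injective e))) (φ-twins i j)))
    disjoint {inj₁ i} {inj₂ j} (inj₁ refl) (_ , e) = ⊥-elim (φ≢rung i e)
    disjoint {inj₁ i} {inj₂ j} (inj₂ (refl , _)) (_ , ())
    disjoint {inj₂ j} {inj₁ i} (_ , e) (inj₁ refl) = ⊥-elim (φ≢rung i e)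
    disjoint {inj₂ j} {inj₁ i} (_ , refl) (inj₂ (() , _))
    disjoint {inj₂ j} {inj₂ j′} (_ , refl) (_ , refl) = refl

    meets : ∀ β → ∃[ a ] (encode a ∈ S × Block β a)
    meets (inj₁ i) with encode (φ i) ∈? S
    ... | yes φi∈S = φ i , φi∈S , inj₁ refl
    ... | no φi∉S = hub , dominating-contains-hub dom (pendant-encode (pend i)) φi∉S , inj₂ (refl , φi∉S)
    meets (inj₂ j) with resolving-contains-twin res (λ e → x≢y (encode-injective e)) (rungs-twins j)
      where
      x≢y : rung j true ≢ rung j false
      x≢y ()
    ... | inj₁ x∈S = rung j true , x∈S , true , refl
    ... | inj₂ y∈S = rung j false , y∈S , false , refl

    Block′ : Fin (k + p) → Fin N → Set
    Block′ β u = Block (splitAt k β) (decode u)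

    disjoint′ : ∀ {β β′ u} → Block′ β u → Block′ β′ u → β ≡ β′
    disjoint′ {β} {β′} {u} b b′ =
      trans (≡-sym (join-splitAt k p β))
        (trans (cong (join k p) (disjoint {splitAt k β} {splitAt k β′} {decode u} b b′)) (join-splitAt k p β′))

    meets′ : ∀ β → ∃[ u ] (u ∈ S × Block′ β u)
    meets′ β with meets (splitAt k β)
    ... | a , a∈S , block = encode a , a∈S , subst (Block (splitAt k β)) (≡-sym (decode-encode a)) block

  rung-level-injective : ∀ s {i j} → level (rung i s) ≡ level (rung j s) → rung i s ≡ rung j s
  rung-level-injective s e = cong (λ (i : Fin p) → rung i s) (toℕ-injective (+-cancelˡ-≡ 3 _ _ e))

  chosen : Bool → Vtx → Bool
  chosen withHub hub = withHub
  chosen _ root       = false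
  chosen _ (leaf _)   = true
  chosen _ (rung _ s) = s

  rungsChosen : Subset (p + p)
  rungsChosen = full {p} ++ empty {p}

  chosenSet : Bool → Subset N
  chosenSet withHub = withHub ∷ false ∷ (full {m} ++ rungsChosen)

  chosenSet-lookup : ∀ withHub a → lookup (chosenSet withHub) (encode a) ≡ chosen withHub a
  chosenSet-lookup _ hub = refl
  chosenSet-lookup _ root = refl
  chosenSet-lookup _ (leaf j) = trans (lookup-++ˡ (full {m}) rungsChosen j) (lookup-replicate j true)
  chosenSet-lookup _ (rung i true) = trans (lookup-++ʳ (full {m}) rungsChosen (i ↑ˡ p))
    (trans (lookup-++ˡ (full {p}) (empty {p}) i) (lookup-replicate i true))
  chosenSet-lookup _ (rung i false) = trans (lookup-++ʳ (full {m}) rungsChosen (p ↑ʳ i))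
    (trans (lookup-++ʳ (full {p}) (empty {p}) i) (lookup-replicate i false))

  chosen-∈ : ∀ {withHub} a → chosen withHub a ≡ true → encode a ∈ chosenSet withHub
  chosen-∈ {withHub} a e = lookup⇒[]= (encode a) _ (trans (chosenSet-lookup withHub a) e)

  ∉-unchosen : ∀ {withHub u} → u ∉ chosenSet withHub → chosen withHub (decode u) ≡ false
  ∉-unchosen {withHub} {u} u∉S with chosen withHub (decode u) in e
  ... | false = refl
  ... | true = ⊥-elim (u∉S (subst (_∈ chosenSet withHub) (encode-decode u) (chosen-∈ (decode u) e)))

  chosenSet-size : ∣ full {m} ++ rungsChosen ∣ ≡ m + p
  chosenSet-size = trans (∣++∣ (full {m}) rungsChosen) (cong₂ _+_ (∣⊤∣≡n m)
    (trans (∣++∣ (full {p}) (empty {p})) (trans (cong₂ _+_ (∣⊤∣≡n p) (∣⊥∣≡0 p)) (+-identityʳ p))))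
    where
    ∣++∣ : ∀ {k l} (xs : Subset k) (ys : Subset l) → ∣ xs ++ ys ∣ ≡ ∣ xs ∣ + ∣ ys ∣
    ∣++∣ [] ys = refl
    ∣++∣ (true ∷ xs) ys = cong suc (∣++∣ xs ys)
    ∣++∣ (false ∷ xs) ys = ∣++∣ xs ys

  unchosen-injective : ∀ {withHub} a b → chosen withHub a ≡ false → chosen withHub b ≡ false →
    pot a ≡ pot b → a ≡ b
  unchosen-injective (leaf _) _ () _ _
  unchosen-injective (rung _ true) _ () _ _
  unchosen-injective _ (leaf _) _ () _
  unchosen-injective _ (rung _ true) _ () _
  unchosen-injective hub hub _ _ _ = refl
  unchosen-injective hub root _ _ ()
  unchosen-injective hub (rung _ false) _ _ ()
  unchosen-injective root hub _ _ ()
  unchosen-injective root root _ _ _ = refl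
  unchosen-injective root (rung _ false) _ _ ()
  unchosen-injective (rung _ false) hub _ _ ()
  unchosen-injective (rung _ false) root _ _ ()
  unchosen-injective (rung _ false) (rung _ false) _ _ e = rung-level-injective false e

  chosen-resolving : ∀ withHub → Resolving graph (chosenSet withHub)
  chosen-resolving withHub = landmark-resolving potential (chosen-∈ (leaf zero) refl) dist-to-t₀
    (λ {u} {w} u∉S w∉S e →
      decode-injective (unchosen-injective (decode u) (decode w) (∉-unchosen u∉S) (∉-unchosen w∉S) e))

  chosen-dominating : ∀ withHub → (∃[ c ] (chosen withHub c ≡ true × Adjacent root c)) →
    Dominating graph (chosenSet withHub)
  chosen-dominating withHub rootDominator u u∉S with dominator (decode u) (∉-unchosen u∉S)
    where
    dominator : ∀ a → chosen withHub a ≡ false → ∃[ c ] (chosen withHub c ≡ true × Adjacent a c)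
    dominator hub _ = leaf zero , refl , inj₂ (inj₁ refl)
    dominator root _ = rootDominator
    dominator (rung i false) _ = rung i true , refl , rung-partner i false
    dominator (leaf _) ()
    dominator (rung _ true) ()
  ... | c , c-chosen , adj = encode c , chosen-∈ c c-chosen , adj-encodeʳ u adj

Realisable : ℕ → ℕ → Set₁
Realisable a b = ∃[ G ] (Connected G × EtaPIs G a × EtaIs G b)

-- b = a - 1: without rungs the graph is a star whose k + 2 leaves are the t_j and the root.
-- These pendants force η_p ≥ k + 3 and η ≥ k + 2, attained by the partition into singletons
-- and by the hub together with the t_j.
star-realisable : ∀ k → Realisable (3 + k) (2 + k)
star-realisable k = graph , connected ,
  (subst (HasRDPartitionOfSize graph) size (singleton-partition neighbour) ,
   partition-bound pendant pendant-injective pendant-pendant) ,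
  (chosenSet true , chosen-resolving true , chosen-dominating true (hub , refl , inj₂ (inj₁ refl)) ,
   trans (cong suc chosenSet-size) (cong (2 +_) (+-identityʳ k))) ,
  λ K S → subst (_≤ K) (cong (2 +_) (+-identityʳ k)) (set-bound pendant pendant-injective pendant-pendant K S)
  where
  open Ladder k 0
  size : N ≡ 3 + k
  size = cong (3 +_) (+-identityʳ k)
  pendant : Fin (suc m) → Vtx
  pendant zero = root
  pendant (suc j) = leaf j
  pendant-injective : ∀ {i j} → pendant i ≡ pendant j → i ≡ j
  pendant-injective {zero} {zero} _ = refl
  pendant-injective {suc i} {suc i} refl = refl
  pendant-injective {zero} {suc _} ()
  pendant-injective {suc _} {zero} ()
  pendant-pendant : ∀ i c → Adjacent (pendant i) c → c ≡ hub
  pendant-pendant (suc j) = leaf-pendant j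
  pendant-pendant zero = root-pendant
    where
    -- Without rungs, the root hangs on the hub like a leaf.
    root-pendant : ∀ c → Adjacent root c → c ≡ hub
    root-pendant (rung () _) _
    root-pendant c (inj₂ (inj₁ e)) = level-one c (ℕ-suc-injective e)
    root-pendant c (inj₂ (inj₂ (() , _)))
    root-pendant hub (inj₁ ())
    root-pendant root (inj₁ ())
    root-pendant (leaf _) (inj₁ ())

-- b ≥ a: with k + 2 leaves and p′ + 1 levels of rungs, the pendant leaves force η_p ≥ k + 3
-- and, with the twin rungs, η ≥ (k + 2) + (p′ + 1); the bounds are attained by the
-- partition below and by the set of leaves and rungs x_i.
ladder-realisable : ∀ k p′ → Realisable (3 + k) (2 + k + suc p′)
ladder-realisable k p′ = graph , connected ,
  ((class ∘ decode , covers , resolving , dominating) , partition-bound leaf leaf-injective leaf-pendant) ,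
  ((chosenSet false , chosen-resolving false , chosen-dominating false (rung zero true , refl , inj₁ refl) ,
    chosenSet-size) ,
   set-bound leaf leaf-injective leaf-pendant)
  where
  open Ladder (suc k) (suc p′)

  leaf-injective : ∀ {i j} → leaf i ≡ leaf j → i ≡ j
  leaf-injective refl = refl

  class : Vtx → Fin (suc m)
  class hub            = zero
  class root           = zero
  class (rung _ false) = zero
  class (leaf j)       = suc j
  class (rung _ true)  = suc (suc zero)

  class-t₀ : ∀ a → class a ≡ suc zero → a ≡ leaf zero
  class-t₀ (leaf zero) _ = refl
  class-t₀ (leaf (suc _)) ()
  class-t₀ hub ()
  class-t₀ root ()
  class-t₀ (rung _ true) ()
  class-t₀ (rung _ false) ()

  class-zero : ∀ a → class a ≡ zero → chosen false a ≡ false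
  class-zero hub _ = refl
  class-zero root _ = refl
  class-zero (rung _ false) _ = refl
  class-zero (leaf _) ()
  class-zero (rung _ true) ()

  -- Within a class, distinct vertices have distinct distances to t₀. Class 0 consists of
  -- the vertices left out of chosenSet false, so unchosen-injective covers it.
  class-injective : ∀ a b → class a ≡ class b → pot a ≡ pot b → a ≡ b
  class-injective (leaf _) (leaf _) refl _ = refl
  class-injective (leaf _) (rung _ true) refl ()
  class-injective (rung _ true) (leaf _) refl ()
  class-injective (rung _ true) (rung _ true) _ f = rung-level-injective true f
  class-injective hub b e f = unchosen-injective hub b refl (class-zero b (≡-sym e)) f
  class-injective root b e f = unchosen-injective root b refl (class-zero b (≡-sym e)) f
  class-injective (rung i false) b e f = unchosen-injective (rung i false) b refl (class-zero b (≡-sym e)) f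
  class-injective a hub e f = unchosen-injective a hub (class-zero a e) refl f
  class-injective a root e f = unchosen-injective a root (class-zero a e) refl f
  class-injective a (rung j false) e f = unchosen-injective a (rung j false) (class-zero a e) refl f

  covers : IsPartition graph (suc m) (class ∘ decode)
  covers zero = encode hub , cong class (decode-encode hub)
  covers (suc j) = encode (leaf j) , cong class (decode-encode (leaf j))

  open Classes (class ∘ decode)

  resolving : ResolvingPartition graph (suc m) (class ∘ decode)
  resolving = landmark-resolving-partition potential only-t₀ dist-to-t₀
    (λ {u} {w} e f → decode-injective (class-injective (decode u) (decode w) e f))
    where
    only-t₀ : ∀ w → class (decode w) ≡ class (decode t₀) → w ≡ t₀
    only-t₀ w e = trans (≡-sym (encode-decode w))
      (cong encode (class-t₀ (decode w) (trans e (cong class (decode-encode (leaf zero))))))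

  dominating : DominatingPartition graph (suc m) (class ∘ decode)
  dominating = dominating-by-neighbours lifted
    where
    other-class-neighbour : ∀ a → ∃[ b ] (Adjacent a b × class a ≢ class b)
    other-class-neighbour (leaf _) = hub , inj₁ refl , λ ()
    other-class-neighbour hub = leaf zero , inj₂ (inj₁ refl) , λ ()
    other-class-neighbour root = rung zero true , inj₁ refl , λ ()
    other-class-neighbour (rung i true) = rung i false , rung-partner i true , λ ()
    other-class-neighbour (rung i false) = rung i true , rung-partner i false , λ ()
    lifted : ∀ u → ∃[ w ] (Adj graph u w × class (decode u) ≢ class (decode w))
    lifted u with other-class-neighbour (decode u)
    ... | b , adj , ne =
      encode b , adj-encodeʳ u adj , subst (λ x → class (decode u) ≢ class x) (≡-sym (decode-encode b)) ne

-- Write b = (a - 1) + d: the case d = 0 is the star, d ≥ 1 the ladder with d levels.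
mainTheorem11 : ∀ (a b : ℕ) → 3 ≤ a → a ≤ b + 1 →
    ∃[ G ] (Connected G × EtaPIs G a × EtaIs G b)
mainTheorem11 (suc (suc (suc k))) b (s≤s (s≤s (s≤s _))) a≤b+1
  with m≤n⇒∃[o]m+o≡n (≤-pred (subst (3 + k ≤_) (+-comm b 1) a≤b+1))
... | zero , refl = subst (Realisable (3 + k)) (≡-sym (+-identityʳ (2 + k))) (star-realisable k)
... | suc p′ , refl = ladder-realisable k p′
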